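{- Let $k\ge 1$ be an integer, let $p_1,\dots,p_k$ be distinct primes, let $\Gamma_k$ be the $k$-dprime divisor function graph of $p_1p_2\cdots p_k$ and let $\Gamma_{k-1}$ be the $(k-1)$-dprime divisor function graph of $p_1p_2\cdots p_{k-1}$. Let $v_1,\dots,v_{2^{k-1}}$ be the vertices of $\Gamma_{k-1}$ and $\deg(v_i)$ their degrees in $\Gamma_{k-1}$. Then $$|E(\Gamma_k)|=|E(\Gamma_{k-1})|+\sum_{i=1}^{2^{k-1}}\bigl(\deg(v_i)+1\bigr).$$
   Context: For $n=p_1p_2\cdots p_k$ with $p_1,\dots,p_k$ distinct primes, the $k$-dprime divisor function graph $\Gamma_k=G_{D(n)}$ is the simple graph with vertex set $V(\Gamma_k)=\{u\in\mathbb{Z}_{>0}: u\mid n\}$ and edge set $E(\Gamma_k)=\{uv: u\neq v,\ u\mid v \text{ or } v\mid u\}$. (For $k-1=0$, $\Gamma_0$ is the graph on the single vertex $1$.) -}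

module Defs where

open import Data.Nat using (ℕ; suc; _+_; _<_; _<?_)
open import Data.Nat.Properties using (_≟_)
open import Data.Nat.Divisibility using (_∣_; _∣?_)
open import Data.List using (List; filter; upTo; length; concatMap; [_]; [])
open import Data.Product using (_×_; _,_)
open import Data.Sum using (_⊎_)
open import Relation.Nullary using (¬_; Dec; yes; no)
open import Relation.Nullary.Decidable using (_×-dec_; _⊎-dec_; ¬?)
open import Relation.Binary.PropositionalEquality using (_≡_)

-- Vertex set of the divisor function graph G_{D(n)}: positive divisors of n,
-- listed in increasing order (all divisors lie in 1..n for n ≥ 1).
divisors : ℕ → List ℕ
divisors n = filter (λ d → d ∣? n) (filter (λ d → 1 Data.Nat.≤? d) (upTo (suc n)))

Adj : ℕ → ℕ → Set
Adj u v = (¬ (u ≡ v)) × ((u ∣ v) ⊎ (v ∣ u))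

Adj? : (u v : ℕ) → Dec (Adj u v)
Adj? u v = ¬? (u ≟ v) ×-dec ((u ∣? v) ⊎-dec (v ∣? u))

-- Edge set of G_{D(n)}: each unordered edge {u,v} is listed once as (u,v) with u < v.
edges : ℕ → List (ℕ × ℕ)
edges n = concatMap (λ u → concatMap (λ v → pick u v) (divisors n)) (divisors n)
  where
  pick : ℕ → ℕ → List (ℕ × ℕ)
  pick u v with u <? v | Adj? u v
  ... | yes _ | yes _ = [ (u , v) ]
  ... | _     | _     = []

numEdges : ℕ → ℕ
numEdges n = length (edges n)

degree : ℕ → ℕ → ℕ
degree n v = length (filter (λ u → Adj? u v) (divisors n))

-- The divisors of m·p, for a prime p ∤ m, are the divisors d of m together with the d·p, and an
-- edge joins two divisors when one properly divides the other.  So the edges of Γ_k are the edges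
-- of Γ_{k-1}, their copies {u·p, v·p}, and the pairs {u, d·p} with u ∣ d, of which there are
-- |E(Γ_{k-1})| + 2^{k-1} (those with u ≠ d, plus those with u = d).  Since Σ_v deg(v) = 2|E(Γ_{k-1})|,
-- the total is |E(Γ_{k-1})| + Σ_v (deg(v) + 1).
module Submission where

open import Defs
open import Algebra.Properties.CommutativeSemigroup using (interchange)
open import Data.Fin.Properties using (0≢1+n; suc-injective)
open import Data.List using (List; []; _∷_; _++_; _∷ʳ_; [_]; map; filter; length; concatMap; upTo)
open import Data.List.Membership.Propositional using (_∈_; _∉_)
open import Data.List.Membership.Propositional.Properties
  using (∈-filter⁺; ∈-filter⁻; ∈-upTo⁺; ∈-map⁺; ∈-map⁻; ∈-++⁺ˡ; ∈-++⁺ʳ; ∈-++⁻)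
open import Data.List.Membership.Propositional.Properties.WithK using (unique∧set⇒bag)
open import Data.List.Properties using (map-++; map-∘; map-cong-local; length-++)
open import Data.List.Relation.Binary.BagAndSetEquality using (∼bag⇒↭)
open import Data.List.Relation.Binary.Permutation.Propositional using (_↭_)
import Data.List.Relation.Binary.Permutation.Propositional.Properties as ↭
open import Data.List.Relation.Unary.All as All using (All; []; _∷_)
import Data.List.Relation.Unary.All.Properties as All
open import Data.List.Relation.Unary.Any using (here; there)
open import Data.List.Relation.Unary.Unique.Propositional using (Unique; []; _∷_)
import Data.List.Relation.Unary.Unique.Propositional.Properties as Unique
open import Data.Nat using (ℕ; suc; _+_; _*_; _<_; _<?_; _≤?_; NonZero; >-nonZero; ≢-nonZero⁻¹; z<s; s≤s)
open import Data.Nat.Coprimality using (Coprime; coprime-divisor)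
open import Data.Nat.Divisibility
  using (_∣_; _∤_; _∣?_; divides; ∣-reflexive; ∣-trans; ∣-antisym; 0∣⇒≡0; ∣⇒≤; n∣m*n; m∣m*n; *-monoˡ-∣; *-cancelʳ-∣)
open import Data.Nat.ListAction using (sum; product)
open import Data.Nat.ListAction.Properties using (sum-++; sum-↭; product-++)
open import Data.Nat.Primality
  using (Prime; prime⇒irreducible; prime⇒nonZero; productOfPrimes≢0)
open import Data.Nat.Primality.Factorisation using (factorisationHasAllPrimeFactors)
open import Data.Nat.Properties
  using (_≟_; +-commutativeSemigroup; *-identityʳ; *-comm; *-cancelʳ-≡; <⇒≢; <⇒≱; ≤∧≢⇒<; m*n≢0)
open import Data.Nat.Tactic.RingSolver using (solve-∀)
open import Data.Product using (_×_; _,_; proj₁; proj₂)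
open import Data.Sum using (_⊎_; inj₁; inj₂)
open import Data.Fin using (zero; suc)
open import Data.Vec using (Vec; []; _∷_; lookup; init; last; toList; initLast)
open import Data.Vec.Properties using (toList-∷ʳ)
import Data.Vec.Relation.Unary.All.Properties as VecAll
open import Function using (_∘_)
open import Function.Bundles using (_⇔_; mk⇔; Equivalence)
open import Relation.Nullary using (¬_; Dec; yes; no; contradiction)
open import Relation.Nullary.Decidable using (_×-dec_; _⊎-dec_; ¬?)
open import Relation.Binary.PropositionalEquality
  using (_≡_; _≢_; refl; sym; trans; cong; cong₂; subst; ≢-sym; module ≡-Reasoning)

private
  variable
    A B : Set

χ : Dec A → ℕ
χ (yes _) = 1
χ (no _)  = 0

χ-cong : A ⇔ B → (a : Dec A) (b : Dec B) → χ a ≡ χ b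
χ-cong A⇔B (yes _) (yes _) = refl
χ-cong A⇔B (yes a) (no ¬b) = contradiction (Equivalence.to A⇔B a) ¬b
χ-cong A⇔B (no ¬a) (yes b) = contradiction (Equivalence.from A⇔B b) ¬a
χ-cong A⇔B (no _)  (no _)  = refl

χ-yes : A → (a : Dec A) → χ a ≡ 1
χ-yes _ (yes _) = refl
χ-yes x (no ¬x) = contradiction x ¬x

χ-no : ¬ A → (a : Dec A) → χ a ≡ 0
χ-no ¬x (yes x) = contradiction x ¬x
χ-no _  (no _)  = refl

χ-⊎ : ¬ (A × B) → (a : Dec A) (b : Dec B) → χ (a ⊎-dec b) ≡ χ a + χ b
χ-⊎ disjoint (yes x) (yes y) = contradiction (x , y) disjoint
χ-⊎ disjoint (yes _) (no _)  = refl
χ-⊎ disjoint (no _)  (yes _) = refl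
χ-⊎ disjoint (no _)  (no _)  = refl

∑ : List A → (A → ℕ) → ℕ
∑ xs f = sum (map f xs)

syntax ∑ xs (λ x → e) = ∑[ x ∈ xs ] e

∑-++ : (xs ys : List A) (f : A → ℕ) → ∑ (xs ++ ys) f ≡ ∑ xs f + ∑ ys f
∑-++ xs ys f = trans (cong sum (map-++ f xs ys)) (sum-++ (map f xs) (map f ys))

∑-map : (g : A → B) (xs : List A) (f : B → ℕ) → ∑ (map g xs) f ≡ ∑ xs (f ∘ g)
∑-map g xs f = cong sum (sym (map-∘ xs))

∑-cong : (xs : List A) {f g : A → ℕ} → (∀ {x} → x ∈ xs → f x ≡ g x) → ∑ xs f ≡ ∑ xs g
∑-cong _ f≡g = cong sum (map-cong-local (All.tabulate f≡g))

∑-+ : (xs : List A) (f g : A → ℕ) → ∑[ x ∈ xs ] (f x + g x) ≡ ∑ xs f + ∑ xs g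
∑-+ []       f g = refl
∑-+ (x ∷ xs) f g = trans (cong (f x + g x +_) (∑-+ xs f g))
                         (interchange +-commutativeSemigroup (f x) (g x) (∑ xs f) (∑ xs g))

∑-zero : (xs : List A) → ∑[ x ∈ xs ] 0 ≡ 0
∑-zero []       = refl
∑-zero (x ∷ xs) = ∑-zero xs

∑-one : (xs : List A) → ∑[ x ∈ xs ] 1 ≡ length xs
∑-one []       = refl
∑-one (x ∷ xs) = cong suc (∑-one xs)

∑-comm : (xs : List A) (ys : List B) (f : A → B → ℕ) →
         ∑[ x ∈ xs ] ∑[ y ∈ ys ] f x y ≡ ∑[ y ∈ ys ] ∑[ x ∈ xs ] f x y
∑-comm []       ys f = sym (∑-zero ys)
∑-comm (x ∷ xs) ys f = trans (cong (∑ ys (f x) +_) (∑-comm xs ys f))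
                             (sym (∑-+ ys (f x) (λ y → ∑[ x′ ∈ xs ] f x′ y)))

∑-↭ : {xs ys : List A} (f : A → ℕ) → xs ↭ ys → ∑ xs f ≡ ∑ ys f
∑-↭ f xs↭ys = sum-↭ (↭.map⁺ f xs↭ys)

length-concatMap : (g : A → List B) (xs : List A) → length (concatMap g xs) ≡ ∑ xs (length ∘ g)
length-concatMap g []       = refl
length-concatMap g (x ∷ xs) = trans (length-++ (g x)) (cong (length (g x) +_) (length-concatMap g xs))

length-filter : {P : A → Set} (P? : ∀ x → Dec (P x)) (xs : List A) → length (filter P? xs) ≡ ∑ xs (χ ∘ P?)
length-filter P? []       = refl
length-filter P? (x ∷ xs) with P? x
... | yes _ = cong suc (length-filter P? xs)
... | no _  = length-filter P? xs

occurrences-unique : {xs : List ℕ} {x : ℕ} → Unique xs → x ∈ xs → ∑[ y ∈ xs ] χ (x ≟ y) ≡ 1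
occurrences-unique {x ∷ xs} (x∉xs ∷ _) (here refl) =
  cong₂ _+_ (χ-yes refl (x ≟ x)) (trans (∑-cong xs (λ y∈ → χ-no (All.lookup x∉xs y∈) (x ≟ _))) (∑-zero xs))
occurrences-unique (y∉ys ∷ unique) (there x∈) =
  cong₂ _+_ (χ-no (λ { refl → All.lookup y∉ys x∈ refl }) _) (occurrences-unique unique x∈)

↭-unique : {xs ys : List ℕ} → Unique xs → Unique ys → (∀ {x} → x ∈ xs ⇔ x ∈ ys) → xs ↭ ys
↭-unique uxs uys xs⇔ys = ∼bag⇒↭ (unique∧set⇒bag uxs uys xs⇔ys)

∈-divisors⁻ : ∀ n {d} → d ∈ divisors n → NonZero d × d ∣ n
∈-divisors⁻ n d∈ =
  let d∈range , d∣n = ∈-filter⁻ (_∣? n) {xs = filter (1 ≤?_) (upTo (suc n))} d∈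
  in >-nonZero (proj₂ (∈-filter⁻ (1 ≤?_) {xs = upTo (suc n)} d∈range)) , d∣n

∈-divisors⁺ : ∀ {d n} .{{_ : NonZero n}} → d ∣ n → d ∈ divisors n
∈-divisors⁺ {0}     {n} 0∣n = contradiction (0∣⇒≡0 0∣n) (≢-nonZero⁻¹ n)
∈-divisors⁺ {suc d} {n} d∣n = ∈-filter⁺ (_∣? n) (∈-filter⁺ (1 ≤?_) (∈-upTo⁺ (s≤s (∣⇒≤ d∣n))) z<s) d∣n

divisors-unique : ∀ n → Unique (divisors n)
divisors-unique n = Unique.filter⁺ (_∣? n) (Unique.filter⁺ (1 ≤?_) (Unique.upTo⁺ (suc n)))

-- `edges n` is built from a `where`-bound function that cannot be named directly;
-- unification against the unfolding of `edges` recovers it as `edge`.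
private
  recover : {f : ℕ → ℕ → ℕ → List (ℕ × ℕ)} →
            (∀ n → edges n ≡ concatMap (λ u → concatMap (f n u) (divisors n)) (divisors n)) →
            ℕ → ℕ → ℕ → List (ℕ × ℕ)
  recover {f} _ = f

  edge : ℕ → ℕ → ℕ → List (ℕ × ℕ)
  edge = recover (λ _ → refl)

Edge : ℕ → ℕ → Set
Edge u v = u < v × Adj u v

edge? : (u v : ℕ) → Dec (Edge u v)
edge? u v = (u <? v) ×-dec Adj? u v

private
  length-edge : ∀ n u v → length (edge n u v) ≡ χ (edge? u v)
  length-edge n u v with u <? v | Adj? u v
  ... | yes _ | yes _ = refl
  ... | yes _ | no _  = refl
  ... | no _  | _     = refl

numEdges≡∑ : ∀ n → numEdges n ≡ ∑[ u ∈ divisors n ] ∑[ v ∈ divisors n ] χ (edge? u v)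
numEdges≡∑ n = trans (length-concatMap _ D) (∑-cong D λ {u} _ →
                trans (length-concatMap _ D) (∑-cong D λ {v} _ → length-edge n u v))
  where
  D : List ℕ
  D = divisors n

ProperDivisor : ℕ → ℕ → Set
ProperDivisor d n = d ∣ n × d ≢ n

properDivisor? : (d n : ℕ) → Dec (ProperDivisor d n)
properDivisor? d n = (d ∣? n) ×-dec ¬? (d ≟ n)

edge⇔properDivisor : ∀ {u v} .{{_ : NonZero u}} .{{_ : NonZero v}} → Edge u v ⇔ ProperDivisor u v
edge⇔properDivisor {u} {v} = mk⇔ to from
  where
  to : Edge u v → ProperDivisor u v
  to (u<v , _ , inj₁ u∣v) = u∣v , <⇒≢ u<v
  to (u<v , _ , inj₂ v∣u) = contradiction (∣⇒≤ v∣u) (<⇒≱ u<v)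
  from : ProperDivisor u v → Edge u v
  from (u∣v , u≢v) = ≤∧≢⇒< (∣⇒≤ u∣v) u≢v , u≢v , inj₁ u∣v

adj⇔properDivisor⊎ : ∀ {u v} → Adj u v ⇔ (ProperDivisor u v ⊎ ProperDivisor v u)
adj⇔properDivisor⊎ {u} {v} = mk⇔ to from
  where
  to : Adj u v → ProperDivisor u v ⊎ ProperDivisor v u
  to (u≢v , inj₁ u∣v) = inj₁ (u∣v , u≢v)
  to (u≢v , inj₂ v∣u) = inj₂ (v∣u , ≢-sym u≢v)
  from : ProperDivisor u v ⊎ ProperDivisor v u → Adj u v
  from (inj₁ (u∣v , u≢v)) = u≢v , inj₁ u∣v
  from (inj₂ (v∣u , v≢u)) = ≢-sym v≢u , inj₂ v∣u

properDivisor-asym : ∀ {u v} → ¬ (ProperDivisor u v × ProperDivisor v u)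
properDivisor-asym ((u∣v , u≢v) , (v∣u , _)) = u≢v (∣-antisym u∣v v∣u)

∣⇔properDivisor⊎≡ : ∀ {u v} → u ∣ v ⇔ (ProperDivisor u v ⊎ u ≡ v)
∣⇔properDivisor⊎≡ {u} {v} = mk⇔ to from
  where
  to : u ∣ v → ProperDivisor u v ⊎ u ≡ v
  to u∣v with u ≟ v
  ... | yes u≡v = inj₂ u≡v
  ... | no u≢v  = inj₁ (u∣v , u≢v)
  from : ProperDivisor u v ⊎ u ≡ v → u ∣ v
  from (inj₁ (u∣v , _)) = u∣v
  from (inj₂ u≡v)       = ∣-reflexive u≡v

χ-adj : ∀ u v → χ (Adj? u v) ≡ χ (properDivisor? u v) + χ (properDivisor? v u)
χ-adj u v = trans (χ-cong adj⇔properDivisor⊎ (Adj? u v) (properDivisor? u v ⊎-dec properDivisor? v u))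
                  (χ-⊎ properDivisor-asym (properDivisor? u v) (properDivisor? v u))

χ-∣ : ∀ u v → χ (u ∣? v) ≡ χ (properDivisor? u v) + χ (u ≟ v)
χ-∣ u v = trans (χ-cong ∣⇔properDivisor⊎≡ (u ∣? v) (properDivisor? u v ⊎-dec (u ≟ v)))
                (χ-⊎ (λ ((_ , u≢v) , u≡v) → u≢v u≡v) (properDivisor? u v) (u ≟ v))

properDivisorPairs : List ℕ → List ℕ → ℕ
properDivisorPairs us vs = ∑[ u ∈ us ] ∑[ v ∈ vs ] χ (properDivisor? u v)

numEdges≡properDivisorPairs : ∀ n → numEdges n ≡ properDivisorPairs (divisors n) (divisors n)
numEdges≡properDivisorPairs n = trans (numEdges≡∑ n) (∑-cong D λ u∈ → ∑-cong D λ v∈ →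
  χ-cong (edge⇔properDivisor {{proj₁ (∈-divisors⁻ n u∈)}} {{proj₁ (∈-divisors⁻ n v∈)}}) _ _)
  where
  D : List ℕ
  D = divisors n

∑-degree : ∀ n → ∑[ v ∈ divisors n ] degree n v ≡
                 properDivisorPairs (divisors n) (divisors n) + properDivisorPairs (divisors n) (divisors n)
∑-degree n = begin
  ∑[ v ∈ D ] degree n v
    ≡⟨ ∑-cong D (λ {v} _ → length-filter (λ u → Adj? u v) D) ⟩
  ∑[ v ∈ D ] ∑[ u ∈ D ] χ (Adj? u v)
    ≡⟨ ∑-cong D (λ {v} _ → ∑-cong D λ {u} _ → χ-adj u v) ⟩
  ∑[ v ∈ D ] ∑[ u ∈ D ] (χ (properDivisor? u v) + χ (properDivisor? v u))
    ≡⟨ ∑-cong D (λ {v} _ → ∑-+ D _ _) ⟩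
  ∑[ v ∈ D ] (∑[ u ∈ D ] χ (properDivisor? u v) + ∑[ u ∈ D ] χ (properDivisor? v u))
    ≡⟨ ∑-+ D _ _ ⟩
  ∑[ v ∈ D ] ∑[ u ∈ D ] χ (properDivisor? u v) + properDivisorPairs D D
    ≡⟨ cong (_+ properDivisorPairs D D) (∑-comm D D (λ v u → χ (properDivisor? u v))) ⟩
  properDivisorPairs D D + properDivisorPairs D D
    ∎
  where
  open ≡-Reasoning
  D : List ℕ
  D = divisors n

properDivisorPairs-++ˡ : ∀ us us′ vs → properDivisorPairs (us ++ us′) vs ≡ properDivisorPairs us vs + properDivisorPairs us′ vs
properDivisorPairs-++ˡ us us′ vs = ∑-++ us us′ _

properDivisorPairs-++ʳ : ∀ us vs vs′ → properDivisorPairs us (vs ++ vs′) ≡ properDivisorPairs us vs + properDivisorPairs us vs′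
properDivisorPairs-++ʳ us vs vs′ = trans (∑-cong us λ _ → ∑-++ vs vs′ _) (∑-+ us _ _)

properDivisorPairs-↭ : ∀ {us us′ vs vs′} → us ↭ us′ → vs ↭ vs′ → properDivisorPairs us vs ≡ properDivisorPairs us′ vs′
properDivisorPairs-↭ {us} us↭us′ vs↭vs′ = trans (∑-cong us λ {u} _ → ∑-↭ _ vs↭vs′) (∑-↭ _ us↭us′)

properDivisor-*ʳ⇔ : ∀ {a b} p .{{_ : NonZero p}} → ProperDivisor (a * p) (b * p) ⇔ ProperDivisor a b
properDivisor-*ʳ⇔ {a} {b} p = mk⇔
  (λ (ap∣bp , ap≢bp) → *-cancelʳ-∣ p ap∣bp , ap≢bp ∘ cong (_* p))
  (λ (a∣b , a≢b) → *-monoˡ-∣ p a∣b , a≢b ∘ *-cancelʳ-≡ a b p)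

properDivisorPairs-*ʳ : ∀ us vs p .{{_ : NonZero p}} →
  properDivisorPairs (map (_* p) us) (map (_* p) vs) ≡ properDivisorPairs us vs
properDivisorPairs-*ʳ us vs p = trans (∑-map (_* p) us _) (∑-cong us λ {a} _ →
  trans (∑-map (_* p) vs _) (∑-cong vs λ {b} _ → χ-cong (properDivisor-*ʳ⇔ p) _ _))

prime∤⇒coprime : ∀ {p n} → Prime p → p ∤ n → Coprime n p
prime∤⇒coprime p-prime p∤n (i∣n , i∣p) with prime⇒irreducible p-prime i∣p
... | inj₁ i≡1 = i≡1
... | inj₂ refl = contradiction i∣n p∤n

module _ {m p : ℕ} .{{_ : NonZero m}} (p-prime : Prime p) (p∤m : p ∤ m) where

  private
    instance
      p≢0 : NonZero p
      p≢0 = prime⇒nonZero p-prime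
      mp≢0 : NonZero (m * p)
      mp≢0 = m*n≢0 m p

    D pD : List ℕ
    D  = divisors m
    pD = map (_* p) D

    ∣m : ∀ {d} → d ∈ D → d ∣ m
    ∣m = proj₂ ∘ ∈-divisors⁻ m

    p∤divisor : ∀ {d} → d ∈ D → p ∤ d
    p∤divisor d∈ p∣d = p∤m (∣-trans p∣d (∣m d∈))

    ∣*p⇒∣ : ∀ {u d} → p ∤ u → u ∣ d * p → u ∣ d
    ∣*p⇒∣ {u} p∤u u∣dp = coprime-divisor (prime∤⇒coprime p-prime p∤u) (subst (u ∣_) (*-comm _ p) u∣dp)

    ∈-divisors-*p⇔ : ∀ {x} → x ∈ divisors (m * p) ⇔ x ∈ D ++ pD
    ∈-divisors-*p⇔ {x} = mk⇔ to from
      where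
      to : x ∈ divisors (m * p) → x ∈ D ++ pD
      to x∈ with proj₂ (∈-divisors⁻ (m * p) x∈) | p ∣? x
      ... | qp∣mp | yes (divides q refl) = ∈-++⁺ʳ D (∈-map⁺ (_* p) {x = q} (∈-divisors⁺ (*-cancelʳ-∣ p qp∣mp)))
      ... | x∣mp  | no p∤x               = ∈-++⁺ˡ (∈-divisors⁺ (∣*p⇒∣ p∤x x∣mp))
      from : x ∈ D ++ pD → x ∈ divisors (m * p)
      from x∈ with ∈-++⁻ D x∈
      ... | inj₁ x∈D = ∈-divisors⁺ (∣-trans (∣m x∈D) (m∣m*n p))
      ... | inj₂ x∈pD with ∈-map⁻ (_* p) x∈pD
      ...   | d , d∈D , refl = ∈-divisors⁺ (*-monoˡ-∣ p (∣m d∈D))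

    D-pD-disjoint : ∀ {x} → ¬ (x ∈ D × x ∈ pD)
    D-pD-disjoint (x∈D , x∈pD) with ∈-map⁻ (_* p) x∈pD
    ... | d , _ , refl = p∤divisor x∈D (n∣m*n d)

  divisors-*p↭ : divisors (m * p) ↭ D ++ pD
  divisors-*p↭ = ↭-unique (divisors-unique (m * p))
    (Unique.++⁺ (divisors-unique m) (Unique.map⁺ (λ {x} {y} → *-cancelʳ-≡ x y p) (divisors-unique m)) D-pD-disjoint)
    ∈-divisors-*p⇔

  private
    properDivisor-*p⇔ : ∀ {u d} → p ∤ u → ProperDivisor u (d * p) ⇔ u ∣ d
    properDivisor-*p⇔ {u} {d} p∤u = mk⇔
      (λ (u∣dp , _) → ∣*p⇒∣ p∤u u∣dp)
      (λ u∣d → ∣-trans u∣d (m∣m*n p) , λ u≡dp → p∤u (subst (p ∣_) (sym u≡dp) (n∣m*n d)))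

    pD-D-pairs : properDivisorPairs pD D ≡ 0
    pD-D-pairs = trans (∑-map (_* p) D _) (trans (∑-cong D λ {a} _ →
      trans (∑-cong D λ b∈ → χ-no (λ (ap∣b , _) → p∤divisor b∈ (∣-trans (n∣m*n a) ap∣b)) _)
            (∑-zero D)) (∑-zero D))

    D-pD-pairs : properDivisorPairs D pD ≡ properDivisorPairs D D + length D
    D-pD-pairs = begin
      ∑[ u ∈ D ] ∑[ v ∈ pD ] χ (properDivisor? u v)
        ≡⟨ ∑-cong D (λ _ → ∑-map (_* p) D _) ⟩
      ∑[ u ∈ D ] ∑[ d ∈ D ] χ (properDivisor? u (d * p))
        ≡⟨ ∑-cong D (λ u∈ → ∑-cong D λ _ → χ-cong (properDivisor-*p⇔ (p∤divisor u∈)) _ _) ⟩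
      ∑[ u ∈ D ] ∑[ d ∈ D ] χ (u ∣? d)
        ≡⟨ ∑-cong D (λ {u} _ → ∑-cong D λ {d} _ → χ-∣ u d) ⟩
      ∑[ u ∈ D ] ∑[ d ∈ D ] (χ (properDivisor? u d) + χ (u ≟ d))
        ≡⟨ ∑-cong D (λ {u} u∈ → trans (∑-+ D _ _)
             (cong (∑[ d ∈ D ] χ (properDivisor? u d) +_) (occurrences-unique (divisors-unique m) u∈))) ⟩
      ∑[ u ∈ D ] (∑[ d ∈ D ] χ (properDivisor? u d) + 1)
        ≡⟨ ∑-+ D _ _ ⟩
      properDivisorPairs D D + ∑[ u ∈ D ] 1
        ≡⟨ cong (properDivisorPairs D D +_) (∑-one D) ⟩
      properDivisorPairs D D + length D
        ∎
      where open ≡-Reasoning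

  numEdges-*-prime : numEdges (m * p) ≡ numEdges m + ∑[ v ∈ divisors m ] (degree m v + 1)
  numEdges-*-prime = begin
    numEdges (m * p)
      ≡⟨ numEdges≡properDivisorPairs (m * p) ⟩
    properDivisorPairs (divisors (m * p)) (divisors (m * p))
      ≡⟨ properDivisorPairs-↭ divisors-*p↭ divisors-*p↭ ⟩
    properDivisorPairs (D ++ pD) (D ++ pD)
      ≡⟨ properDivisorPairs-++ˡ D pD (D ++ pD) ⟩
    properDivisorPairs D (D ++ pD) + properDivisorPairs pD (D ++ pD)
      ≡⟨ cong₂ _+_ (properDivisorPairs-++ʳ D D pD) (properDivisorPairs-++ʳ pD D pD) ⟩
    (E + properDivisorPairs D pD) + (properDivisorPairs pD D + properDivisorPairs pD pD)
      ≡⟨ cong₂ _+_ (cong (E +_) D-pD-pairs) (cong₂ _+_ pD-D-pairs (properDivisorPairs-*ʳ D D p)) ⟩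
    (E + (E + L)) + (0 + E)
      ≡⟨ rearrange E L ⟩
    E + ((E + E) + L)
      ≡⟨ cong₂ _+_ (numEdges≡properDivisorPairs m) (trans (∑-+ D _ _) (cong₂ _+_ (∑-degree m) (∑-one D))) ⟨
    numEdges m + ∑[ v ∈ D ] (degree m v + 1)
      ∎
    where
    open ≡-Reasoning
    E L : ℕ
    E = properDivisorPairs D D
    L = length D
    rearrange : ∀ e l → (e + (e + l)) + (0 + e) ≡ e + ((e + e) + l)
    rearrange = solve-∀

product-∷ʳ : ∀ ns n → product (ns ∷ʳ n) ≡ product ns * n
product-∷ʳ ns n = trans (product-++ ns [ n ]) (cong (product ns *_) (*-identityʳ n))

prime∤product : ∀ {p qs} → Prime p → All Prime qs → p ∉ qs → p ∤ product qs
prime∤product p-prime qs-prime p∉qs p∣∏qs = p∉qs (factorisationHasAllPrimeFactors p-prime p∣∏qs qs-prime)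

∉-unique-∷ʳ : ∀ {xs : List A} {y} → Unique (xs ∷ʳ y) → y ∉ xs
∉-unique-∷ʳ {xs = x ∷ xs} (x∉ ∷ _) (here refl) = All.lookup x∉ (∈-++⁺ʳ xs (here refl)) refl
∉-unique-∷ʳ {xs = x ∷ xs} (_ ∷ unique) (there y∈) = ∉-unique-∷ʳ unique y∈

toList-init-last : ∀ {n} (xs : Vec A (suc n)) → toList xs ≡ toList (init xs) ∷ʳ last xs
toList-init-last xs = trans (cong toList (proj₂ (proj₂ (initLast xs)))) (toList-∷ʳ (last xs) (init xs))

lookup-injective⇒unique : ∀ {n} (xs : Vec A n) → (∀ i j → lookup xs i ≡ lookup xs j → i ≡ j) → Unique (toList xs)
lookup-injective⇒unique []       _   = []
lookup-injective⇒unique (x ∷ xs) inj =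
  VecAll.toList⁺ (VecAll.lookup⁻ λ i x≡xᵢ → 0≢1+n (inj zero (suc i) x≡xᵢ)) ∷
  lookup-injective⇒unique xs (λ i j xᵢ≡xⱼ → suc-injective (inj (suc i) (suc j) xᵢ≡xⱼ))

lemma2p8 : (k : ℕ) (ps : Vec ℕ (suc k)) →
    (∀ i → Prime (lookup ps i)) →
    (∀ i j → lookup ps i ≡ lookup ps j → i ≡ j) →
    numEdges (product (toList ps))
      ≡ numEdges (product (toList (init ps)))
        + sum (map (λ v → degree (product (toList (init ps))) v + 1)
                   (divisors (product (toList (init ps)))))
lemma2p8 k ps prime distinct = begin
  numEdges (product (toList ps))  ≡⟨ cong (numEdges ∘ product) (toList-init-last ps) ⟩
  numEdges (product (qs ∷ʳ p))    ≡⟨ cong numEdges (product-∷ʳ qs p) ⟩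
  numEdges (product qs * p)       ≡⟨ numEdges-*-prime {{productOfPrimes≢0 qs-prime}} p-prime
                                       (prime∤product p-prime qs-prime p∉qs) ⟩
  numEdges (product qs) + ∑[ v ∈ divisors (product qs) ] (degree (product qs) v + 1) ∎
  where
  open ≡-Reasoning
  qs : List ℕ
  qs = toList (init ps)
  p : ℕ
  p = last ps
  all-prime : All Prime (qs ∷ʳ p)
  all-prime = subst (All Prime) (toList-init-last ps) (VecAll.toList⁺ (VecAll.lookup⁻ prime))
  qs-prime : All Prime qs
  qs-prime = All.++⁻ˡ qs all-prime
  p-prime : Prime p
  p-prime = All.head (All.++⁻ʳ qs all-prime)
  p∉qs : p ∉ qs
  p∉qs = ∉-unique-∷ʳ (subst Unique (toList-init-last ps) (lookup-injective⇒unique ps distinct))
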